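{- Let $k\ge 2$ and $\ell\ge 1$ be integers. Let $d(i)_{i\ge 0}$ and $u(i)_{i\ge0}$ be periodic integer sequences with period lengths $\ell$ and $k\ell$, respectively. Let $r,s$ be nonnegative integers such that $r-s+k-1\ge 0$. Let $w(i)_{i\ge 0}$ be an integer sequence such that, for all $0\le m\le k-1$ and all $i\ge 0$, \[ w(ki+r+m) = \begin{cases} u(ki+m) & \text{if } 0\le m\le k-2,\\ w(i+s)+d(i) & \text{if } m=k-1.\end{cases} \] Then $w(i)_{i\ge 0}$ is $k$-regular.
   Context: For an integer $k\ge 2$ and a sequence $s(i)_{i\ge0}$, the $k$-kernel of $s$ is the set of subsequences $\{ s(k^e i + j)_{i\ge 0} : e\ge 0,\ 0\le j\le k^e-1\}$. The sequence is $k$-regular if the $\mathbb{Q}$-vector space spanned by its $k$-kernel is finite-dimensional. -}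

module Defs where

open import Data.Nat using (ℕ; zero; suc; _+_; _*_; _^_; _<_)
open import Data.Integer using (ℤ)
open import Data.Fin using (Fin)
import Data.Fin as Fin
open import Data.Rational using (ℚ; 0ℚ; _/_)
import Data.Rational as ℚ
open import Data.Product using (Σ; ∃; _×_)
open import Relation.Binary.PropositionalEquality using (_≡_)

toℚ : ℤ → ℚ
toℚ z = z / 1

∑ : (N : ℕ) → (Fin N → ℚ) → ℚ
∑ zero    f = 0ℚ
∑ (suc N) f = f Fin.zero ℚ.+ ∑ N (λ t → f (Fin.suc t))

Periodic : (ℕ → ℤ) → ℕ → Set
Periodic s p = ∀ i → s (i + p) ≡ s i

kernelSeq : (k : ℕ) → (ℕ → ℤ) → (e j : ℕ) → ℕ → ℚ
kernelSeq k s e j i = toℚ (s (k ^ e * i + j))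

InSpan : {N : ℕ} → (Fin N → ℕ → ℚ) → (ℕ → ℚ) → Set
InSpan {N} g f = Σ (Fin N → ℚ) λ c → ∀ i → f i ≡ ∑ N (λ t → c t ℚ.* g t i)

-- k-regular: the ℚ-vector space spanned by the k-kernel is finite-dimensional,
-- i.e. contained in the span of finitely many rational sequences.
Regular : (k : ℕ) → (ℕ → ℤ) → Set
Regular k s = Σ ℕ λ N → Σ (Fin N → ℕ → ℚ) λ g →
  ∀ e j → j < k ^ e → InSpan g (kernelSeq k s e j)

{-# OPTIONS --safe #-}
-- For i ≥ r, unwinding the recurrence along the base-k digits of k^e i + j − r either
-- ends in a value of u, which is periodic in i, or after e steps reaches w (i + c − r)
-- with c bounded independently of e, collecting periodic values of d on the way.
-- So every kernel sequence agrees for i ≥ r with α · w (i + c − r) + p i, p of period kℓ,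
-- and lies in the span of the r point indicators, the finitely many shifts of w and
-- the kℓ indicators of residue classes modulo kℓ.
module Submission where

open import Defs
open import Data.Nat using (ℕ; zero; suc; _+_; _*_; _∸_; _≤_; _<_; _^_; z≤n; s≤s; _/_; _%_; NonZero)
open import Data.Nat.Properties
open import Data.Nat.DivMod using (m≡m%n+[m/n]*n; m%n<n)
open import Data.Nat.Tactic.RingSolver using (solve-∀)
open import Data.Integer using (ℤ)
import Data.Integer as ℤ
import Data.Integer.Properties as ℤ
open import Data.Rational using (ℚ; 0ℚ; 1ℚ)
import Data.Rational as ℚ
import Data.Rational.Properties as ℚ
import Data.Rational.Unnormalised as ℚᵘ
import Data.Rational.Unnormalised.Properties as ℚᵘ
open import Data.Fin using (Fin; toℕ; splitAt)
import Data.Fin as Fin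
open import Data.Vec.Functional using (_++_)
open import Data.Sum using (inj₁; inj₂)
open import Data.Sum.Properties using ([,]-map)
open import Data.Product using (Σ; _×_; _,_)
open import Data.Bool using (if_then_else_)
open import Function using (_∘_)
open import Relation.Nullary using (yes; no; does)
open import Relation.Nullary.Decidable using (dec-true; dec-false)
open import Relation.Binary.PropositionalEquality
import Algebra.Properties.Group as GroupProperties

toℚ-homo-+ : ∀ a b → toℚ (a ℤ.+ b) ≡ toℚ a ℚ.+ toℚ b
toℚ-homo-+ a b = ℚ.toℚᵘ-injective (begin
  ℚ.toℚᵘ (toℚ (a ℤ.+ b))             ≈⟨ toℚᵘ∘toℚ (a ℤ.+ b) ⟩
  ℚᵘ.mkℚᵘ (a ℤ.+ b) 0                ≈⟨ ℚᵘ.*≡* (cong₂ (λ x y → (x ℤ.+ y) ℤ.* ℤ.+ 1) (sym (ℤ.*-identityʳ a)) (sym (ℤ.*-identityʳ b))) ⟩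
  ℚᵘ.mkℚᵘ a 0 ℚᵘ.+ ℚᵘ.mkℚᵘ b 0       ≈⟨ ℚᵘ.+-cong (ℚᵘ.≃-sym (toℚᵘ∘toℚ a)) (ℚᵘ.≃-sym (toℚᵘ∘toℚ b)) ⟩
  ℚ.toℚᵘ (toℚ a) ℚᵘ.+ ℚ.toℚᵘ (toℚ b) ≈⟨ ℚᵘ.≃-sym (ℚ.toℚᵘ-homo-+ (toℚ a) (toℚ b)) ⟩
  ℚ.toℚᵘ (toℚ a ℚ.+ toℚ b)           ∎)
  where
  open ℚᵘ.≃-Reasoning
  toℚᵘ∘toℚ : ∀ z → ℚ.toℚᵘ (toℚ z) ℚᵘ.≃ ℚᵘ.mkℚᵘ z 0
  toℚᵘ∘toℚ z = ℚ.toℚᵘ-fromℚᵘ (ℚᵘ.mkℚᵘ z 0)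

x-y+y≡x : ∀ x y → (x ℚ.- y) ℚ.+ y ≡ x
x-y+y≡x x y = GroupProperties.//-rightDividesˡ ℚ.+-0-group y x

δ : ℕ → ℕ → ℚ
δ x a = if does (x ≟ a) then 1ℚ else 0ℚ

δ-refl : ∀ a → δ a a ≡ 1ℚ
δ-refl a = cong (if_then 1ℚ else 0ℚ) (dec-true (a ≟ a) refl)

δ-≢ : ∀ {x a} → x ≢ a → δ x a ≡ 0ℚ
δ-≢ {x} {a} x≢a = cong (if_then 1ℚ else 0ℚ) (dec-false (x ≟ a) x≢a)

δ-mod : ∀ P .{{_ : NonZero P}} → Fin P → ℕ → ℚ
δ-mod P t i = δ (toℕ t) (i % P)

∑-cong : ∀ n {f g : Fin n → ℚ} → (∀ t → f t ≡ g t) → ∑ n f ≡ ∑ n g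
∑-cong zero    f≗g = refl
∑-cong (suc n) f≗g = cong₂ ℚ._+_ (f≗g Fin.zero) (∑-cong n (f≗g ∘ Fin.suc))

∑-++ : ∀ m {n} (f : Fin m → ℚ) (g : Fin n → ℚ) → ∑ (m + n) (f ++ g) ≡ ∑ m f ℚ.+ ∑ n g
∑-++ zero    f g = sym (ℚ.+-identityˡ _)
∑-++ (suc m) f g = begin
  f Fin.zero ℚ.+ ∑ (m + _) ((f ++ g) ∘ Fin.suc)
    ≡⟨ cong (f Fin.zero ℚ.+_) (∑-cong (m + _) (λ t → [,]-map (splitAt m t))) ⟩
  f Fin.zero ℚ.+ ∑ (m + _) ((f ∘ Fin.suc) ++ g)        ≡⟨ cong (f Fin.zero ℚ.+_) (∑-++ m (f ∘ Fin.suc) g) ⟩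
  f Fin.zero ℚ.+ (∑ m (f ∘ Fin.suc) ℚ.+ ∑ _ g)         ≡⟨ sym (ℚ.+-assoc (f Fin.zero) _ _) ⟩
  f Fin.zero ℚ.+ ∑ m (f ∘ Fin.suc) ℚ.+ ∑ _ g           ∎
  where open ≡-Reasoning

∑-zero : ∀ n (G : ℕ → ℚ) → (∀ x → x < n → G x ≡ 0ℚ) → ∑ n (G ∘ toℕ) ≡ 0ℚ
∑-zero zero    G G≡0 = refl
∑-zero (suc n) G G≡0 = begin
  G 0 ℚ.+ ∑ n ((G ∘ suc) ∘ toℕ)
    ≡⟨ cong₂ ℚ._+_ (G≡0 0 (s≤s z≤n)) (∑-zero n (G ∘ suc) (λ x x<n → G≡0 (suc x) (s≤s x<n))) ⟩
  0ℚ ℚ.+ 0ℚ                     ≡⟨ ℚ.+-identityˡ 0ℚ ⟩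
  0ℚ                            ∎
  where open ≡-Reasoning

∑-single : ∀ n (G : ℕ → ℚ) {a} → a < n → (∀ x → x ≢ a → G x ≡ 0ℚ) → ∑ n (G ∘ toℕ) ≡ G a
∑-single (suc n) G {zero} _ G≡0 = begin
  G 0 ℚ.+ ∑ n ((G ∘ suc) ∘ toℕ) ≡⟨ cong (G 0 ℚ.+_) (∑-zero n (G ∘ suc) (λ x _ → G≡0 (suc x) λ ())) ⟩
  G 0 ℚ.+ 0ℚ                    ≡⟨ ℚ.+-identityʳ (G 0) ⟩
  G 0                           ∎
  where open ≡-Reasoning
∑-single (suc n) G {suc a} (s≤s a<n) G≡0 = begin
  G 0 ℚ.+ ∑ n ((G ∘ suc) ∘ toℕ)
    ≡⟨ cong₂ ℚ._+_ (G≡0 0 λ ()) (∑-single n (G ∘ suc) a<n (λ x x≢a → G≡0 (suc x) (x≢a ∘ suc-injective))) ⟩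
  0ℚ ℚ.+ G (suc a)              ≡⟨ ℚ.+-identityˡ (G (suc a)) ⟩
  G (suc a)                     ∎
  where open ≡-Reasoning

∑-*-δ : ∀ n (f : ℕ → ℚ) {a} → a < n → ∑ n (λ t → f (toℕ t) ℚ.* δ (toℕ t) a) ≡ f a
∑-*-δ n f {a} a<n = begin
  ∑ n (λ t → f (toℕ t) ℚ.* δ (toℕ t) a)
    ≡⟨ ∑-single n (λ x → f x ℚ.* δ x a) a<n (λ x x≢a → trans (cong (f x ℚ.*_) (δ-≢ x≢a)) (ℚ.*-zeroʳ (f x))) ⟩
  f a ℚ.* δ a a                          ≡⟨ cong (f a ℚ.*_) (δ-refl a) ⟩
  f a ℚ.* 1ℚ                             ≡⟨ ℚ.*-identityʳ (f a) ⟩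
  f a                                    ∎
  where open ≡-Reasoning

Periodic-+* : ∀ {f L} → Periodic f L → ∀ x t → f (x + t * L) ≡ f x
Periodic-+* {f} {L} f-per x zero    = cong f (+-identityʳ x)
Periodic-+* {f} {L} f-per x (suc t) = begin
  f (x + (L + t * L)) ≡⟨ cong f (trans (cong (x +_) (+-comm L (t * L))) (sym (+-assoc x (t * L) L))) ⟩
  f (x + t * L + L)   ≡⟨ f-per (x + t * L) ⟩
  f (x + t * L)       ≡⟨ Periodic-+* f-per x t ⟩
  f x                 ∎
  where open ≡-Reasoning

Periodic-multiple : ∀ {f L} → Periodic f L → ∀ m → Periodic f (m * L)
Periodic-multiple f-per m i = Periodic-+* f-per i m

Periodic-mod : ∀ {f L} .{{_ : NonZero L}} → Periodic f L → ∀ i → f (i % L) ≡ f i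
Periodic-mod {f} {L} f-per i = trans (sym (Periodic-+* f-per (i % L) (i / L))) (cong f (sym (m≡m%n+[m/n]*n i L)))

Periodic-+ : ∀ {f g L} → Periodic f L → Periodic g L → Periodic (λ i → f i ℤ.+ g i) L
Periodic-+ f-per g-per i = cong₂ ℤ._+_ (f-per i) (g-per i)

Periodic-∘-affine : ∀ {f L} → Periodic f L → ∀ a b → Periodic (λ i → f (a * i + b)) L
Periodic-∘-affine {f} {L} f-per a b i =
  trans (cong f (affine-shift a i L b)) (Periodic-+* f-per (a * i + b) a)
  where
  affine-shift : ∀ a i L b → a * (i + L) + b ≡ a * i + b + a * L
  affine-shift = solve-∀

Periodic-back : ∀ {f L} → Periodic f (suc L) → ∀ {x y} a → x + a ≡ y → f x ≡ f (y + a * L)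
Periodic-back {f} {L} f-per {x} {y} a x+a≡y = begin
  f x                 ≡⟨ sym (Periodic-+* f-per x a) ⟩
  f (x + a * suc L)   ≡⟨ cong f (trans (cong (x +_) (*-suc a L)) (sym (+-assoc x a (a * L)))) ⟩
  f (x + a + a * L)   ≡⟨ cong (λ y → f (y + a * L)) x+a≡y ⟩
  f (y + a * L)       ∎
  where open ≡-Reasoning

module _ {m : ℕ} {g : Fin m → ℕ → ℚ} where

  InSpan-resp : ∀ {f f′ : ℕ → ℚ} → (∀ i → f i ≡ f′ i) → InSpan g f → InSpan g f′
  InSpan-resp f≗f′ (c , f≡∑) = c , λ i → trans (sym (f≗f′ i)) (f≡∑ i)

  InSpan-++ : ∀ {n} {h : Fin n → ℕ → ℚ} {f f′ : ℕ → ℚ} →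
              InSpan g f → InSpan h f′ → InSpan (g ++ h) (λ i → f i ℚ.+ f′ i)
  InSpan-++ {n} {h} {f} {f′} (c , f≡∑) (c′ , f′≡∑) = c ++ c′ , λ i → begin
    f i ℚ.+ f′ i                                                  ≡⟨ cong₂ ℚ._+_ (f≡∑ i) (f′≡∑ i) ⟩
    ∑ m (λ t → c t ℚ.* g t i) ℚ.+ ∑ n (λ t → c′ t ℚ.* h t i)      ≡⟨ sym (∑-++ m _ _) ⟩
    ∑ (m + n) ((λ t → c t ℚ.* g t i) ++ (λ t → c′ t ℚ.* h t i))  ≡⟨ ∑-cong (m + n) (terms i) ⟩
    ∑ (m + n) (λ t → (c ++ c′) t ℚ.* (g ++ h) t i)                ∎
    where
    open ≡-Reasoning
    terms : ∀ i t → ((λ t → c t ℚ.* g t i) ++ (λ t → c′ t ℚ.* h t i)) t ≡ (c ++ c′) t ℚ.* (g ++ h) t i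
    terms i t with splitAt m t
    ... | inj₁ _ = refl
    ... | inj₂ _ = refl

InSpan-*-generator : ∀ n (g : ℕ → ℕ → ℚ) {c} → c < n → ∀ α →
                     InSpan {n} (g ∘ toℕ) (λ i → α ℚ.* g c i)
InSpan-*-generator n g {c} c<n α = (λ t → α ℚ.* δ (toℕ t) c) , λ i → sym (begin
  ∑ n (λ t → α ℚ.* δ (toℕ t) c ℚ.* g (toℕ t) i)
    ≡⟨ ∑-single n (λ x → α ℚ.* δ x c ℚ.* g x i) c<n (vanishes i) ⟩
  α ℚ.* δ c c ℚ.* g c i                          ≡⟨ cong (λ y → α ℚ.* y ℚ.* g c i) (δ-refl c) ⟩
  α ℚ.* 1ℚ ℚ.* g c i                             ≡⟨ cong (ℚ._* g c i) (ℚ.*-identityʳ α) ⟩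
  α ℚ.* g c i                                    ∎)
  where
  open ≡-Reasoning
  vanishes : ∀ i x → x ≢ c → α ℚ.* δ x c ℚ.* g x i ≡ 0ℚ
  vanishes i x x≢c = begin
    α ℚ.* δ x c ℚ.* g x i ≡⟨ cong (λ y → α ℚ.* y ℚ.* g x i) (δ-≢ x≢c) ⟩
    α ℚ.* 0ℚ ℚ.* g x i    ≡⟨ cong (ℚ._* g x i) (ℚ.*-zeroʳ α) ⟩
    0ℚ ℚ.* g x i          ≡⟨ ℚ.*-zeroˡ (g x i) ⟩
    0ℚ                    ∎

finiteSupport⇒InSpan-δ : ∀ n {f : ℕ → ℚ} → (∀ i → n ≤ i → f i ≡ 0ℚ) → InSpan {n} (δ ∘ toℕ) f
finiteSupport⇒InSpan-δ n {f} f≡0 = f ∘ toℕ , f≡∑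
  where
  f≡∑ : ∀ i → f i ≡ ∑ n (λ t → f (toℕ t) ℚ.* δ (toℕ t) i)
  f≡∑ i with i <? n
  ... | yes i<n = sym (∑-*-δ n f i<n)
  ... | no  i≮n = trans (f≡0 i (≮⇒≥ i≮n)) (sym (∑-zero n (λ x → f x ℚ.* δ x i) λ x x<n →
                    trans (cong (f x ℚ.*_) (δ-≢ (<⇒≢ (<-≤-trans x<n (≮⇒≥ i≮n))))) (ℚ.*-zeroʳ (f x))))

periodic⇒InSpan-δ-mod : ∀ P .{{_ : NonZero P}} {f : ℕ → ℤ} → Periodic f P → InSpan (δ-mod P) (toℚ ∘ f)
periodic⇒InSpan-δ-mod P {f} f-per = toℚ ∘ f ∘ toℕ , λ i →
  sym (trans (∑-*-δ P (toℚ ∘ f) (m%n<n i P)) (cong toℚ (Periodic-mod f-per i)))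

module Recurrence (k₂ ℓ₂ r s : ℕ) (d u w : ℕ → ℤ)
  (d-periodic : Periodic d (suc ℓ₂))
  (u-periodic : Periodic u (suc (suc k₂) * suc ℓ₂))
  (w≡u : ∀ m i → m + 2 ≤ suc (suc k₂) → w (suc (suc k₂) * i + r + m) ≡ u (suc (suc k₂) * i + m))
  (w≡w+d : ∀ i → w (suc (suc k₂) * i + r + suc k₂) ≡ w (i + s) ℤ.+ d i) where

  k ℓ P B C : ℕ
  k = suc (suc k₂)
  ℓ = suc ℓ₂
  P = k * ℓ
  B = r + (k₂ * r + k * s)
  C = suc (suc B)

  shifted : ℕ → ℕ → ℚ
  shifted c i = toℚ (w (i + c ∸ r))

  -- Encodes  w (k^e i + j − r) = α · w (i + c − r) + p i  for i ≥ r;  z stands for k^e i + j − r.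
  record Decomposition (e j : ℕ) : Set where
    field
      α          : ℚ
      c          : ℕ
      c<C        : c < C
      p          : ℕ → ℤ
      p-periodic : Periodic p P
      agrees     : ∀ i z → r ≤ i → z + r ≡ k ^ e * i + j →
                   toℚ (w z) ≡ α ℚ.* shifted c i ℚ.+ toℚ (p i)

  digit quot : ℕ → ℕ
  digit j = (j + k₂ * r) % k
  quot  j = (j + k₂ * r) / k

  -- k^(e+1) i + j − 2r = k (k^e i + quot j − r) + digit j, since k r − 2r = k₂ r.
  split-index : ∀ e j {i z} → r ≤ i → z + r ≡ k ^ suc e * i + j →
                Σ ℕ λ q → q + r ≡ k ^ e * i + quot j × z ≡ k * q + r + digit j
  split-index e j {i} {z} r≤i z+r≡ = q , q+r≡ , z≡
    where
    q : ℕ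
    q = k ^ e * i + quot j ∸ r
    q+r≡ : q + r ≡ k ^ e * i + quot j
    q+r≡ = m∸n+n≡m (≤-trans (≤-trans r≤i (m≤n*m i (k ^ e) {{m^n≢0 k e}})) (m≤m+n _ (quot j)))
    regroup₁ : ∀ k₂ q r m → suc (suc k₂) * q + r + m + r + k₂ * r ≡ suc (suc k₂) * (q + r) + m
    regroup₁ = solve-∀
    regroup₂ : ∀ k a i q m → k * (a * i + q) + m ≡ k * a * i + (m + q * k)
    regroup₂ = solve-∀
    z≡ : z ≡ k * q + r + digit j
    z≡ = sym (+-cancelʳ-≡ r _ _ (+-cancelʳ-≡ (k₂ * r) _ _ (begin
      k * q + r + digit j + r + k₂ * r        ≡⟨ regroup₁ k₂ q r (digit j) ⟩
      k * (q + r) + digit j                   ≡⟨ cong (λ y → k * y + digit j) q+r≡ ⟩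
      k * (k ^ e * i + quot j) + digit j      ≡⟨ regroup₂ k (k ^ e) i (quot j) (digit j) ⟩
      k ^ suc e * i + (digit j + quot j * k)  ≡⟨ cong (k ^ suc e * i +_) (sym (m≡m%n+[m/n]*n (j + k₂ * r) k)) ⟩
      k ^ suc e * i + (j + k₂ * r)            ≡⟨ sym (+-assoc _ j (k₂ * r)) ⟩
      k ^ suc e * i + j + k₂ * r              ≡⟨ cong (_+ k₂ * r) (sym z+r≡) ⟩
      z + r + k₂ * r                          ∎)))
      where open ≡-Reasoning

  quot-bound : ∀ e j → j ≤ k ^ suc e + B → quot j + s ≤ k ^ e + B
  quot-bound e j j≤ = *-cancelˡ-≤ k (begin
    k * (quot j + s)                      ≡⟨ trans (*-distribˡ-+ k (quot j) s) (cong (_+ k * s) (*-comm k (quot j))) ⟩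
    quot j * k + k * s                    ≤⟨ +-monoˡ-≤ (k * s) (m≤n+m (quot j * k) (digit j)) ⟩
    digit j + quot j * k + k * s          ≡⟨ cong (_+ k * s) (sym (m≡m%n+[m/n]*n (j + k₂ * r) k)) ⟩
    j + k₂ * r + k * s                    ≡⟨ +-assoc j (k₂ * r) (k * s) ⟩
    j + (k₂ * r + k * s)                  ≤⟨ +-monoˡ-≤ _ j≤ ⟩
    k * k ^ e + B + (k₂ * r + k * s)      ≡⟨ +-assoc (k * k ^ e) B _ ⟩
    k * k ^ e + (B + (k₂ * r + k * s))    ≤⟨ +-monoʳ-≤ (k * k ^ e) (+-monoʳ-≤ B B+k₂B) ⟩
    k * k ^ e + k * B                     ≡⟨ sym (*-distribˡ-+ k (k ^ e) B) ⟩
    k * (k ^ e + B)                       ∎)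
    where
    open ≤-Reasoning
    B+k₂B : k₂ * r + k * s ≤ B + k₂ * B
    B+k₂B = ≤-trans (m≤n+m _ r) (m≤m+n B (k₂ * B))

  decompose-base : ∀ j → j < C → Decomposition 0 j
  decompose-base j j<C = record
    { α = 1ℚ ; c = j ; c<C = j<C ; p = λ _ → ℤ.+ 0 ; p-periodic = λ _ → refl
    ; agrees = λ i z _ z+r≡ → begin
        toℚ (w z)                       ≡⟨ cong (toℚ ∘ w) (z≡ i z z+r≡) ⟩
        shifted j i                     ≡⟨ sym (ℚ.*-identityˡ _) ⟩
        1ℚ ℚ.* shifted j i              ≡⟨ sym (ℚ.+-identityʳ _) ⟩
        1ℚ ℚ.* shifted j i ℚ.+ 0ℚ       ∎ }
    where
    open ≡-Reasoning
    z≡ : ∀ i z → z + r ≡ 1 * i + j → z ≡ i + j ∸ r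
    z≡ i z z+r≡ = trans (sym (m+n∸n≡m z r)) (cong (_∸ r) (trans z+r≡ (cong (_+ j) (*-identityˡ i))))

  decompose-u : ∀ e j → digit j ≤ k₂ → Decomposition (suc e) j
  decompose-u e j m≤k₂ = record
    { α = 0ℚ ; c = 0 ; c<C = s≤s z≤n
    ; p = p ; p-periodic = Periodic-∘-affine u-periodic (k ^ suc e) _
    ; agrees = agrees }
    where
    -- (r + r) * (P ∸ 1) ≡ − 2r modulo P, so  p i = u (k^(e+1) i + j − 2r).
    p : ℕ → ℤ
    p i = u (k ^ suc e * i + (j + (r + r) * (P ∸ 1)))
    m+2≤k : digit j + 2 ≤ k
    m+2≤k = subst (digit j + 2 ≤_) (+-comm k₂ 2) (+-monoˡ-≤ 2 m≤k₂)
    agrees : ∀ i z → r ≤ i → z + r ≡ k ^ suc e * i + j →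
             toℚ (w z) ≡ 0ℚ ℚ.* shifted 0 i ℚ.+ toℚ (p i)
    agrees i z r≤i z+r≡ with split-index e j r≤i z+r≡
    ... | q , _ , z≡ = begin
      toℚ (w z)                                        ≡⟨ cong toℚ (trans (cong w z≡) (w≡u (digit j) q m+2≤k)) ⟩
      toℚ (u (k * q + digit j))                        ≡⟨ cong toℚ (Periodic-back u-periodic (r + r) unshift) ⟩
      toℚ (u (k ^ suc e * i + j + (r + r) * (P ∸ 1)))  ≡⟨ cong (toℚ ∘ u) (+-assoc (k ^ suc e * i) j _) ⟩
      toℚ (p i)                                        ≡⟨ sym (ℚ.+-identityˡ _) ⟩
      0ℚ ℚ.+ toℚ (p i)                                 ≡⟨ cong (ℚ._+ toℚ (p i)) (sym (ℚ.*-zeroˡ (shifted 0 i))) ⟩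
      0ℚ ℚ.* shifted 0 i ℚ.+ toℚ (p i)                 ∎
      where
      open ≡-Reasoning
      regroup : ∀ a m r → a + m + (r + r) ≡ a + r + m + r
      regroup = solve-∀
      unshift : k * q + digit j + (r + r) ≡ k ^ suc e * i + j
      unshift = trans (regroup (k * q) (digit j) r) (trans (cong (_+ r) (sym z≡)) z+r≡)

  decompose-d : ∀ e j → digit j ≡ suc k₂ → Decomposition e (quot j + s) → Decomposition (suc e) j
  decompose-d e j m≡k-1 D = record
    { α = α ; c = c ; c<C = c<C
    ; p = p′ ; p-periodic = Periodic-+ p-periodic d-part-periodic
    ; agrees = agrees′ }
    where
    open Decomposition D
    p′ : ℕ → ℤ
    p′ i = p i ℤ.+ d (k ^ e * i + (quot j + r * ℓ₂))
    d-part-periodic : Periodic (λ i → d (k ^ e * i + (quot j + r * ℓ₂))) P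
    d-part-periodic = Periodic-∘-affine (Periodic-multiple d-periodic k) (k ^ e) _
    agrees′ : ∀ i z → r ≤ i → z + r ≡ k ^ suc e * i + j →
              toℚ (w z) ≡ α ℚ.* shifted c i ℚ.+ toℚ (p′ i)
    agrees′ i z r≤i z+r≡ with split-index e j r≤i z+r≡
    ... | q , q+r≡ , z≡ = begin
      toℚ (w z)
        ≡⟨ cong toℚ (trans (cong w (trans z≡ (cong (k * q + r +_) m≡k-1))) (w≡w+d q)) ⟩
      toℚ (w (q + s) ℤ.+ d q)                          ≡⟨ toℚ-homo-+ (w (q + s)) (d q) ⟩
      toℚ (w (q + s)) ℚ.+ toℚ (d q)
        ≡⟨ cong₂ ℚ._+_ (agrees i (q + s) r≤i q+s+r≡) (cong toℚ d≡) ⟩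
      α ℚ.* shifted c i ℚ.+ toℚ (p i) ℚ.+ toℚ (d _)    ≡⟨ ℚ.+-assoc (α ℚ.* shifted c i) (toℚ (p i)) _ ⟩
      α ℚ.* shifted c i ℚ.+ (toℚ (p i) ℚ.+ toℚ (d _))
        ≡⟨ cong (α ℚ.* shifted c i ℚ.+_) (sym (toℚ-homo-+ (p i) _)) ⟩
      α ℚ.* shifted c i ℚ.+ toℚ (p′ i)                 ∎
      where
      open ≡-Reasoning
      regroup : ∀ q s r → q + s + r ≡ q + r + s
      regroup = solve-∀
      q+s+r≡ : q + s + r ≡ k ^ e * i + (quot j + s)
      q+s+r≡ = trans (regroup q s r) (trans (cong (_+ s) q+r≡) (+-assoc _ (quot j) s))
      d≡ : d q ≡ d (k ^ e * i + (quot j + r * ℓ₂))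
      d≡ = trans (Periodic-back d-periodic r q+r≡) (cong d (+-assoc (k ^ e * i) (quot j) _))

  decompose : ∀ e j → j ≤ k ^ e + B → Decomposition e j
  decompose zero    j j≤ = decompose-base j (s≤s j≤)
  decompose (suc e) j j≤ with digit j ≤? k₂
  ... | yes m≤k₂ = decompose-u e j m≤k₂
  ... | no  m≰k₂ = decompose-d e j (≤-antisym (≤-pred (m%n<n (j + k₂ * r) k)) (≰⇒> m≰k₂))
                                   (decompose e (quot j + s) (quot-bound e j j≤))

  generators : Fin (r + (C + P)) → ℕ → ℚ
  generators = (δ ∘ toℕ {r}) ++ ((shifted ∘ toℕ {C}) ++ δ-mod P)

  kernelSeq∈span : ∀ e j → j < k ^ e → InSpan generators (kernelSeq k w e j)
  kernelSeq∈span e j j<k^e =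
    InSpan-resp (λ i → x-y+y≡x (kernelSeq k w e j i) (R i))
      (InSpan-++ (finiteSupport⇒InSpan-δ r vanishes)
        (InSpan-++ (InSpan-*-generator C shifted c<C α) (periodic⇒InSpan-δ-mod P p-periodic)))
    where
    open Decomposition (decompose e (j + r) (+-mono-≤ (<⇒≤ j<k^e) (m≤m+n r _)))
    R : ℕ → ℚ
    R i = α ℚ.* shifted c i ℚ.+ toℚ (p i)
    vanishes : ∀ i → r ≤ i → kernelSeq k w e j i ℚ.- R i ≡ 0ℚ
    vanishes i r≤i = begin
      kernelSeq k w e j i ℚ.- R i
        ≡⟨ cong (ℚ._- R i) (agrees i (k ^ e * i + j) r≤i (+-assoc (k ^ e * i) j r)) ⟩
      R i ℚ.- R i                 ≡⟨ ℚ.+-inverseʳ (R i) ⟩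
      0ℚ                          ∎
      where open ≡-Reasoning

  regular : Regular k w
  regular = r + (C + P) , generators , kernelSeq∈span

theorem1p6 : (k ℓ : ℕ) → 2 ≤ k → 1 ≤ ℓ →
    (d u : ℕ → ℤ) → Periodic d ℓ → Periodic u (k * ℓ) →
    (r s : ℕ) → s ≤ r + (k ∸ 1) →
    (w : ℕ → ℤ) →
    (∀ m i → m + 2 ≤ k → w (k * i + r + m) ≡ u (k * i + m)) →
    (∀ i → w (k * i + r + (k ∸ 1)) ≡ w (i + s) ℤ.+ d i) →
    Regular k w
-- s ≤ r + k − 1 only ensures that the recurrence determines w.
theorem1p6 (suc (suc k₂)) (suc ℓ₂) (s≤s (s≤s _)) (s≤s _) d u d-periodic u-periodic r s _ w w≡u w≡w+d =
  Recurrence.regular k₂ ℓ₂ r s d u w d-periodic u-periodic w≡u w≡w+d
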